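{- Let $S\in\Sigma^n$, let $\ell^*$ be a natural number and let $m_1<m_2<\dots<m_h$ ($h\ge 3$) be consecutive midpoints of $\ell^*$-palindromes in $S$ with $m_{j+1}-m_j\le\ell^*/2$ for all $j\in\{1,\dots,h-1\}$ (an $\ell^*$-run). Then (a) $m_{k+1}-m_k=m_2-m_1$ for all $k\in\{1,\dots,h-1\}$; (b) with $w=S[m_1+1,m_2]$ and $w^R$ its reverse, $$S[m_1+1,m_h]=\begin{cases}(ww^R)^{\frac{h-1}{2}} & h\text{ odd},\\ (ww^R)^{\frac{h-2}{2}}\,w & h\text{ even}.\end{cases}$$
   Context: $S[i,j]$ denotes $S[i]\cdots S[j]$. Palindromes are considered in their even form: $S$ contains a palindrome of length $\ell$ with midpoint $m$ if $S[m-i+1]=S[m+i]$ for all $i\in\{1,\dots,\ell\}$ (indices within $\{1,\dots,n\}$); $\ell(m)$ is the maximal such $\ell$. The palindrome centered at $m$ is an $\ell^*$-palindrome if $\ell(m)\ge\ell^*$. "Consecutive" means that no other index between $m_1$ and $m_h$ is the midpoint of an $\ell^*$-palindrome. -}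

module Defs where

open import Data.Nat using (ℕ; zero; suc; _+_; _*_; _∸_; _≤_; _<_)
open import Data.Vec using (Vec; toList)
open import Data.List using (List; []; _∷_; _++_; take; drop; reverse; concat; replicate)
open import Data.Maybe using (Maybe; just; nothing)
open import Data.Product using (∃; _×_)
open import Relation.Binary.PropositionalEquality using (_≡_)

-- 1-based character access on lists: listAt xs i = just xs[i] if 1 ≤ i ≤ length xs,
-- nothing otherwise (in particular for i = 0).
listAt : {A : Set} → List A → ℕ → Maybe A
listAt []       _             = nothing
listAt (x ∷ xs) zero          = nothing
listAt (x ∷ xs) (suc zero)    = just x
listAt (x ∷ xs) (suc (suc i)) = listAt xs (suc i)

_‼_ : {A : Set} {n : ℕ} → Vec A n → ℕ → Maybe A
S ‼ i = listAt (toList S) i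

-- S contains an (even) palindrome of length ℓ with midpoint m:
-- for all i ∈ {1,…,ℓ}, both indices m-i+1 and m+i lie in {1,…,n}
-- and S[m-i+1] = S[m+i].  (For 1 ≤ i, m + 1 ∸ i ≥ 1 iff i ≤ m.)
HasPal : {A : Set} {n : ℕ} → Vec A n → ℕ → ℕ → Set
HasPal {A} S ℓ m =
  ∀ i → 1 ≤ i → i ≤ ℓ →
    ∃ λ (a : A) → (S ‼ (m + 1 ∸ i) ≡ just a) × (S ‼ (m + i) ≡ just a)

-- m is the midpoint of an ℓ*-palindrome, i.e. ℓ(m) ≥ ℓ*.  Since the set of
-- lengths ℓ with HasPal S ℓ m is downward closed, ℓ(m) ≥ ℓ* ⇔ HasPal S ℓ* m.
IsPalMid : {A : Set} {n : ℕ} → Vec A n → ℕ → ℕ → Set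
IsPalMid S ℓ* m = HasPal S ℓ* m

-- The substring S[i,j] = S[i] ⋯ S[j] (1-based, inclusive), as a list.
substr : {A : Set} {n : ℕ} → Vec A n → ℕ → ℕ → List A
substr S i j = take (suc j ∸ i) (drop (i ∸ 1) (toList S))

pow : {A : Set} → List A → ℕ → List A
pow u k = concat (replicate k u)

-- An ℓ-palindrome at m is the reflection symmetry x ↦ 2m + 1 − x of S on the window
-- m − ℓ + 1 … m + ℓ. Two reflections at m < m′ compose to the shift by 2(m′ − m) on the
-- overlap of their windows. So if a < b < c are consecutive midpoints with gaps at most
-- ℓ/2 and b − a ≠ c − b, reflecting the farther neighbour across b (giving 2b − c or
-- 2b − a) produces a midpoint strictly between them: each required equality of letters is
-- a chain of at most three reflections and shifts staying inside the windows. Hence all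
-- gaps equal D = m₂ − m₁, and the palindrome at m₁ + jD makes the (j+1)-st block of length
-- D after m₁ the reverse of the j-th, so the blocks alternate w, wᴿ.

module Submission where

open import Data.Nat using (ℕ; zero; suc; _+_; _*_; _∸_; _≤_; _<_; z≤n; s≤s; _≤?_; _<?_)
open import Data.Nat.Properties
open import Data.Nat.Tactic.RingSolver using (solve)
open import Data.Vec using (Vec; toList)
open import Data.List using (List; _∷_; []; _++_; reverse; take; drop)
open import Data.List.Properties using (unfold-reverse; reverse-involutive; ++-assoc; ++-identityʳ; drop-drop; take-[])
open import Data.Maybe using (Maybe; just; nothing)
open import Data.Maybe.Properties using (just-injective)
open import Data.Product using (∃; _×_; _,_)
open import Data.Empty using (⊥-elim)
open import Relation.Binary.PropositionalEquality
open import Relation.Nullary using (yes; no; ¬_; contradiction)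
open import Relation.Binary.Definitions using (tri<; tri≈; tri>)
open import Function using (_∘_)
open import Defs

-- Linear arithmetic by certificate: A ≤ B follows from a sum L ≤ R of hypotheses
-- (assembled with _⊕_) whenever B + L ≡ A + R + C is a polynomial identity, which
-- the ring solver checks.
≤-by : ∀ {A B L R} C → L ≤ R → B + L ≡ A + R + C → A ≤ B
≤-by {A} {B} {L} {R} C L≤R eq = +-cancelʳ-≤ L A B (begin
  A + L           ≤⟨ +-monoʳ-≤ A L≤R ⟩
  A + R           ≤⟨ m≤m+n (A + R) C ⟩
  A + R + C       ≡⟨ sym eq ⟩
  B + L           ∎)
  where open ≤-Reasoning

≡-by : ∀ {A B L R} → L ≡ R → A + R ≡ B + L → A ≡ B
≡-by {A} {B} {L} {R} L≡R eq = +-cancelʳ-≡ R A B (trans eq (cong (B +_) L≡R))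

infixl 6 _⊕_
_⊕_ : ∀ {a b c d} → a ≤ b → c ≤ d → a + c ≤ b + d
_⊕_ = +-mono-≤

module Mirrors {A : Set} (f : ℕ → Maybe A) where

  infix 4 _≐_
  _≐_ : ℕ → ℕ → Set
  x ≐ y = ∃ λ a → f x ≡ just a × f y ≡ just a

  ≐-sym : ∀ {x y} → x ≐ y → y ≐ x
  ≐-sym (a , fx , fy) = a , fy , fx

  ≐-trans : ∀ {x y z} → x ≐ y → y ≐ z → x ≐ z
  ≐-trans (a , fx , fy) (b , fy′ , fz) =
    a , fx , trans fz (cong just (just-injective (trans (sym fy′) fy)))

  Pal : ℕ → ℕ → Set
  Pal ℓ m = ∀ i → 1 ≤ i → i ≤ ℓ → ∃ λ a → f (m + 1 ∸ i) ≡ just a × f (m + i) ≡ just a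

  -- Positions x and y are mirror images about the midpoint m iff x + y = 2m + 1;
  -- the bound x, y ≤ m + ℓ cuts out the window of an ℓ-palindrome at m.
  Mirror : ℕ → ℕ → Set
  Mirror ℓ m = ∀ x y → x + y ≡ suc (m + m) → x ≤ m + ℓ → y ≤ m + ℓ → x ≐ y

  NoMirrorBetween : ℕ → ℕ → ℕ → Set
  NoMirrorBetween ℓ u v = ∀ x → u < x → x < v → ¬ Mirror ℓ x

  mirror-from-lower-half : ∀ {ℓ m} →
    (∀ x y → x + y ≡ suc (m + m) → x ≤ m → y ≤ m + ℓ → x ≐ y) → Mirror ℓ m
  mirror-from-lower-half {ℓ} {m} half x y x+y x≤ y≤ with x ≤? m
  ... | yes x≤m = half x y x+y x≤m y≤
  ... | no x≰m  = ≐-sym (half y x (trans (+-comm y x) x+y) y≤m x≤)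
    where
    y≤m : y ≤ m
    y≤m = ≤-by 0 (≤-reflexive x+y ⊕ ≰⇒> x≰m) (solve (x ∷ y ∷ m ∷ []))

  pal-pair : ∀ {ℓ m} → Pal ℓ m → ∀ x k → x + k ≡ m → suc k ≤ ℓ → x ≐ m + suc k
  pal-pair {ℓ} {m} pal x k x+k 1+k≤ℓ with pal (suc k) (s≤s z≤n) 1+k≤ℓ
  ... | a , fx , fy = a , subst (λ t → f t ≡ just a) m+1∸[1+k]≡x fx , fy
    where
    open ≡-Reasoning
    m+1∸[1+k]≡x : m + 1 ∸ suc k ≡ x
    m+1∸[1+k]≡x = begin
      m + 1 ∸ suc k  ≡⟨ cong (_∸ suc k) (+-comm m 1) ⟩
      m ∸ k          ≡⟨ cong (_∸ k) (sym x+k) ⟩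
      x + k ∸ k      ≡⟨ m+n∸n≡m x k ⟩
      x              ∎

  pal⇒mirror : ∀ {ℓ m} → Pal ℓ m → Mirror ℓ m
  pal⇒mirror {ℓ} {m} pal = mirror-from-lower-half half
    where
    half : ∀ x y → x + y ≡ suc (m + m) → x ≤ m → y ≤ m + ℓ → x ≐ y
    half x y x+y x≤m y≤ with m ∸ x | m+[n∸m]≡n x≤m
    ... | k | x+k = subst (x ≐_) m+1+k≡y (pal-pair pal x k x+k 1+k≤ℓ)
      where
      m+1+k≡y : m + suc k ≡ y
      m+1+k≡y = ≡-by (cong₂ _+_ (sym x+y) x+k) (solve (x ∷ y ∷ k ∷ m ∷ []))
      1+k≤ℓ : suc k ≤ ℓ
      1+k≤ℓ = ≤-by 0 (≤-reflexive m+1+k≡y ⊕ y≤) (solve (y ∷ k ∷ m ∷ ℓ ∷ []))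

  mirror⇒pal : ∀ {ℓ m} → ℓ ≤ m → Mirror ℓ m → Pal ℓ m
  mirror⇒pal {ℓ} {m} ℓ≤m mirror i 1≤i i≤ℓ with m + 1 ∸ i | m∸n+n≡m i≤m+1
    where
    i≤m+1 : i ≤ m + 1
    i≤m+1 = ≤-trans i≤ℓ (≤-trans ℓ≤m (m≤m+n m 1))
  ... | k | k+i = mirror k (m + i) k+m+i (≤-by ℓ (≤-reflexive k+i ⊕ 1≤i) (solve (k ∷ i ∷ m ∷ ℓ ∷ [])))
                    (+-monoʳ-≤ m i≤ℓ)
    where
    k+m+i : k + (m + i) ≡ suc (m + m)
    k+m+i = ≡-by k+i (solve (k ∷ i ∷ m ∷ []))

  pal⇒radius≤midpoint : ∀ {ℓ m} → f 0 ≡ nothing → Pal ℓ m → ℓ ≤ m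
  pal⇒radius≤midpoint {ℓ} {m} f0 pal with ℓ ≤? m
  ... | yes ℓ≤m = ℓ≤m
  ... | no  ℓ≰m with pal ℓ (≤-trans (s≤s z≤n) (≰⇒> ℓ≰m)) ≤-refl
  ...   | a , f[m+1∸ℓ] , _ = contradiction (trans (sym f0) f[0]) λ ()
    where
    f[0] : f 0 ≡ just a
    f[0] = subst (λ t → f t ≡ just a) (m≤n⇒m∸n≡0 (subst (_≤ ℓ) (+-comm 1 m) (≰⇒> ℓ≰m))) f[m+1∸ℓ]

  mirror-shift : ∀ {ℓ m d} → ℓ ≤ m → Mirror ℓ m → Mirror ℓ (m + d) →
                 ∀ x → m < x + ℓ → x + d ≤ m + ℓ → x ≐ x + 2 * d
  mirror-shift {ℓ} {m} {d} ℓ≤m mirror mirror′ x m<x+ℓ x+d≤ with suc (m + m) ∸ x | m+[n∸m]≡n x≤2m+1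
    where
    x≤2m+1 : x ≤ suc (m + m)
    x≤2m+1 = ≤-by (1 + d) (x+d≤ ⊕ ℓ≤m) (solve (x ∷ d ∷ m ∷ ℓ ∷ []))
  ... | z | x+z = ≐-trans (mirror x z x+z x≤ z≤) (mirror′ z (x + 2 * d) z+x+2d z≤′ x+2d≤)
    where
    x≤ : x ≤ m + ℓ
    x≤ = ≤-by d x+d≤ (solve (x ∷ d ∷ m ∷ ℓ ∷ []))
    z≤ : z ≤ m + ℓ
    z≤ = ≤-by 0 (≤-reflexive x+z ⊕ m<x+ℓ) (solve (x ∷ z ∷ m ∷ ℓ ∷ []))
    z+x+2d : z + (x + 2 * d) ≡ suc (m + d + (m + d))
    z+x+2d = ≡-by x+z (solve (x ∷ z ∷ d ∷ m ∷ []))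
    z≤′ : z ≤ m + d + ℓ
    z≤′ = ≤-by d z≤ (solve (z ∷ d ∷ m ∷ ℓ ∷ []))
    x+2d≤ : x + 2 * d ≤ m + d + ℓ
    x+2d≤ = ≤-by 0 x+d≤ (solve (x ∷ d ∷ m ∷ ℓ ∷ []))

  -- With b = a + e + d and c = b + d, the new midpoint a + e is 2b − c. Its reflection is
  -- the shift by 2(c − b) followed by the reflection at b; left of the window of b it is
  -- instead the reflection at a followed by two shifts.
  mirror-reflect-rightmost : ∀ {ℓ a e d} → ℓ ≤ a → 2 * (e + d) ≤ ℓ →
    Mirror ℓ a → Mirror ℓ (a + e + d) → Mirror ℓ (a + e + d + d) → Mirror ℓ (a + e)
  mirror-reflect-rightmost {ℓ} {a} {e} {d} ℓ≤a gaps≤ mirrorᵃ mirrorᵇ mirrorᶜ = mirror-from-lower-half half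
    where
    ℓ≤b : ℓ ≤ a + e + d
    ℓ≤b = ≤-by (e + d) ℓ≤a (solve (a ∷ e ∷ d ∷ ℓ ∷ []))
    half : ∀ x y → x + y ≡ suc (a + e + (a + e)) → x ≤ a + e → y ≤ a + e + ℓ → x ≐ y
    half x y x+y x≤q y≤ with a + e + d <? x + ℓ
    ... | yes b<x+ℓ = ≐-trans (mirror-shift ℓ≤b mirrorᵇ mirrorᶜ x b<x+ℓ x+d≤)
                              (mirrorᵇ (x + 2 * d) y x+2d+y x+2d≤ y≤b+ℓ)
      where
      x+d≤ : x + d ≤ a + e + d + ℓ
      x+d≤ = ≤-by (2 * (e + d)) (x≤q ⊕ gaps≤) (solve (x ∷ a ∷ e ∷ d ∷ ℓ ∷ []))
      x+2d+y : x + 2 * d + y ≡ suc (a + e + d + (a + e + d))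
      x+2d+y = ≡-by x+y (solve (x ∷ y ∷ a ∷ e ∷ d ∷ []))
      x+2d≤ : x + 2 * d ≤ a + e + d + ℓ
      x+2d≤ = ≤-by (2 * e + d) (x≤q ⊕ gaps≤) (solve (x ∷ a ∷ e ∷ d ∷ ℓ ∷ []))
      y≤b+ℓ : y ≤ a + e + d + ℓ
      y≤b+ℓ = ≤-by d y≤ (solve (y ∷ a ∷ e ∷ d ∷ ℓ ∷ []))
    ... | no b≮x+ℓ with y ∸ 2 * (e + d) | m∸n+n≡m 2[e+d]≤y
      where
      x+ℓ≤b = ≮⇒≥ b≮x+ℓ
      2[e+d]≤y : 2 * (e + d) ≤ y
      2[e+d]≤y = ≤-by (1 + 3 * e + d) (gaps≤ ⊕ gaps≤ ⊕ x+ℓ≤b ⊕ ≤-reflexive (sym x+y) ⊕ ℓ≤a)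
                   (solve (x ∷ y ∷ a ∷ e ∷ d ∷ ℓ ∷ []))
    ...   | w | w+2[e+d] = subst (x ≐_) w+2[e+d]
              (≐-trans (mirrorᵃ x (w + 2 * d) x+w+2d x≤a+ℓ w+2d≤)
              (≐-trans (≐-sym (mirror-shift ℓ≤b mirrorᵇ mirrorᶜ w b<w+ℓ w+d≤))
                       (mirror-shift ℓ≤a mirrorᵃ (subst (Mirror ℓ) (+-assoc a e d) mirrorᵇ) w a<w+ℓ w+e+d≤)))
      where
      x+ℓ≤b = ≮⇒≥ b≮x+ℓ
      x+w+2d : x + (w + 2 * d) ≡ suc (a + a)
      x+w+2d = ≡-by (cong₂ _+_ x+y w+2[e+d]) (solve (x ∷ y ∷ w ∷ a ∷ e ∷ d ∷ []))
      x≤a+ℓ : x ≤ a + ℓ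
      x≤a+ℓ = ≤-by (ℓ + e + d) (x+ℓ≤b ⊕ gaps≤) (solve (x ∷ a ∷ e ∷ d ∷ ℓ ∷ []))
      w+2d≤ : w + 2 * d ≤ a + ℓ
      w+2d≤ = ≤-by e (≤-reflexive w+2[e+d] ⊕ y≤) (solve (y ∷ w ∷ a ∷ e ∷ d ∷ ℓ ∷ []))
      b<w+ℓ : a + e + d < w + ℓ
      b<w+ℓ = ≤-by (2 * e) (≤-reflexive (sym x+y) ⊕ x+ℓ≤b ⊕ ≤-reflexive (sym w+2[e+d]) ⊕ gaps≤ ⊕ gaps≤)
                (solve (x ∷ y ∷ w ∷ a ∷ e ∷ d ∷ ℓ ∷ []))
      w+d≤ : w + d ≤ a + e + d + ℓ
      w+d≤ = ≤-by (e + 2 * d) w+2d≤ (solve (w ∷ a ∷ e ∷ d ∷ ℓ ∷ []))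
      a<w+ℓ : a < w + ℓ
      a<w+ℓ = ≤-by (e + d) b<w+ℓ (solve (w ∷ a ∷ e ∷ d ∷ ℓ ∷ []))
      w+e+d≤ : w + (e + d) ≤ a + ℓ
      w+e+d≤ = ≤-by d (≤-reflexive w+2[e+d] ⊕ y≤) (solve (y ∷ w ∷ a ∷ e ∷ d ∷ ℓ ∷ []))

  -- The mirror image of `mirror-reflect-rightmost`: with b = a + d, the new midpoint is 2b − a.
  mirror-reflect-leftmost : ∀ {ℓ a d e} → ℓ ≤ a → 2 * (d + e) ≤ ℓ →
    Mirror ℓ a → Mirror ℓ (a + d) → Mirror ℓ (a + d + d + e) → Mirror ℓ (a + d + d)
  mirror-reflect-leftmost {ℓ} {a} {d} {e} ℓ≤a gaps≤ mirrorᵃ mirrorᵇ mirrorᶜ = mirror-from-lower-half half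
    where
    ℓ≤b : ℓ ≤ a + d
    ℓ≤b = ≤-by d ℓ≤a (solve (a ∷ d ∷ ℓ ∷ []))
    half : ∀ x y → x + y ≡ suc (a + d + d + (a + d + d)) → x ≤ a + d + d → y ≤ a + d + d + ℓ → x ≐ y
    half x y x+y x≤q y≤ with y ≤? a + d + ℓ
    ... | no y≰b+ℓ =
      ≐-trans (subst (x ≐_) x+2[d+e]≡x+2e+2d
                (mirror-shift {d = d + e} ℓ≤b mirrorᵇ (subst (Mirror ℓ) (+-assoc (a + d) d e) mirrorᶜ) x b<x+ℓ x+d+e≤))
        (≐-sym (≐-trans (mirrorᶜ y (x + 2 * e) y+x+2e y≤c+ℓ x+2e≤c+ℓ)
                        (mirror-shift ℓ≤a mirrorᵃ mirrorᵇ (x + 2 * e) a<x+2e+ℓ x+2e+d≤)))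
      where
      b+ℓ<y = ≰⇒> y≰b+ℓ
      x+2[d+e]≡x+2e+2d : x + 2 * (d + e) ≡ x + 2 * e + 2 * d
      x+2[d+e]≡x+2e+2d = solve (x ∷ d ∷ e ∷ [])
      y+x+2e : y + (x + 2 * e) ≡ suc (a + d + d + e + (a + d + d + e))
      y+x+2e = ≡-by x+y (solve (x ∷ y ∷ a ∷ d ∷ e ∷ []))
      y≤c+ℓ : y ≤ a + d + d + e + ℓ
      y≤c+ℓ = ≤-by e y≤ (solve (y ∷ a ∷ d ∷ e ∷ ℓ ∷ []))
      x+2e≤c+ℓ : x + 2 * e ≤ a + d + d + e + ℓ
      x+2e≤c+ℓ = ≤-by (e + 2 * d) (x≤q ⊕ gaps≤) (solve (x ∷ a ∷ d ∷ e ∷ ℓ ∷ []))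
      a<x+2e+ℓ : a < x + 2 * e + ℓ
      a<x+2e+ℓ = ≤-by (2 * (d + e)) (≤-reflexive (sym x+y) ⊕ y≤) (solve (x ∷ y ∷ a ∷ d ∷ e ∷ ℓ ∷ []))
      x+2e+d≤ : x + 2 * e + d ≤ a + ℓ
      x+2e+d≤ = ≤-by (2 * e) (≤-reflexive x+y ⊕ b+ℓ<y ⊕ gaps≤ ⊕ gaps≤) (solve (x ∷ y ∷ a ∷ d ∷ e ∷ ℓ ∷ []))
      b<x+ℓ : a + d < x + ℓ
      b<x+ℓ = ≤-by d (≤-reflexive (sym x+y) ⊕ y≤) (solve (x ∷ y ∷ a ∷ d ∷ ℓ ∷ []))
      x+d+e≤ : x + (d + e) ≤ a + d + ℓ
      x+d+e≤ = ≤-by (d + 3 * e) (≤-reflexive x+y ⊕ b+ℓ<y ⊕ gaps≤ ⊕ gaps≤) (solve (x ∷ y ∷ a ∷ d ∷ e ∷ ℓ ∷ []))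
    ... | yes y≤b+ℓ with y ∸ 2 * d | m∸n+n≡m 2d≤y
      where
      2d≤y : 2 * d ≤ y
      2d≤y = ≤-by (a + 1) (≤-reflexive (sym x+y) ⊕ x≤q) (solve (x ∷ y ∷ a ∷ d ∷ []))
    ...   | w | w+2d = subst (x ≐_) w+2d
              (≐-trans (mirrorᵇ x w x+w x≤b+ℓ w≤b+ℓ) (mirror-shift ℓ≤a mirrorᵃ mirrorᵇ w a<w+ℓ w+d≤))
      where
      x+w : x + w ≡ suc (a + d + (a + d))
      x+w = ≡-by (cong₂ _+_ x+y w+2d) (solve (x ∷ y ∷ w ∷ a ∷ d ∷ []))
      x≤b+ℓ : x ≤ a + d + ℓ
      x≤b+ℓ = ≤-by (d + 2 * e) (x≤q ⊕ gaps≤) (solve (x ∷ a ∷ d ∷ e ∷ ℓ ∷ []))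
      w≤b+ℓ : w ≤ a + d + ℓ
      w≤b+ℓ = ≤-by (2 * d) (≤-reflexive w+2d ⊕ y≤b+ℓ) (solve (y ∷ w ∷ a ∷ d ∷ ℓ ∷ []))
      a<w+ℓ : a < w + ℓ
      a<w+ℓ = ≤-by ℓ (≤-reflexive (sym x+y) ⊕ x≤q ⊕ ≤-reflexive (sym w+2d))
                (solve (x ∷ y ∷ w ∷ a ∷ d ∷ ℓ ∷ []))
      w+d≤ : w + d ≤ a + ℓ
      w+d≤ = ≤-by 0 (≤-reflexive w+2d ⊕ y≤b+ℓ) (solve (y ∷ w ∷ a ∷ d ∷ ℓ ∷ []))

  consecutive-gaps-equal : ∀ {ℓ a b c} → ℓ ≤ a → a < b → b < c → 2 * (b ∸ a) ≤ ℓ → 2 * (c ∸ b) ≤ ℓ →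
    Mirror ℓ a → Mirror ℓ b → Mirror ℓ c → NoMirrorBetween ℓ a b → NoMirrorBetween ℓ b c → c ∸ b ≡ b ∸ a
  consecutive-gaps-equal {ℓ} {a} {b} {c} ℓ≤a a<b b<c 2p≤ℓ 2r≤ℓ mirrorᵃ mirrorᵇ mirrorᶜ freeˡ freeʳ
    with b ∸ a | m+[n∸m]≡n (<⇒≤ a<b) | m<n⇒0<n∸m a<b | c ∸ b | m+[n∸m]≡n (<⇒≤ b<c) | m<n⇒0<n∸m b<c
  ... | p | refl | 0<p | r | refl | 0<r with <-cmp p r
  ... | tri≈ _ p≡r _ = sym p≡r
  ... | tri< p<r _ _ = ⊥-elim (freeʳ (a + p + p) (m<m+n (a + p) 0<p) (+-monoʳ-< (a + p) p<r)
          (mirror-reflect-leftmost ℓ≤a (subst (λ t → 2 * t ≤ ℓ) (sym p+e≡r) 2r≤ℓ) mirrorᵃ mirrorᵇ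
             (subst (Mirror ℓ) c≡a+p+p+e mirrorᶜ)))
    where
    e = r ∸ p
    p+e≡r : p + e ≡ r
    p+e≡r = m+[n∸m]≡n (<⇒≤ p<r)
    c≡a+p+p+e : a + p + r ≡ a + p + p + e
    c≡a+p+p+e = trans (cong (a + p +_) (sym p+e≡r)) (sym (+-assoc (a + p) p e))
  ... | tri> _ _ r<p = ⊥-elim (freeˡ (a + e) (m<m+n a (m<n⇒0<n∸m r<p)) a+e<b
          (mirror-reflect-rightmost ℓ≤a (subst (λ t → 2 * t ≤ ℓ) (sym e+r≡p) 2p≤ℓ) mirrorᵃ
             (subst (Mirror ℓ) b≡a+e+r mirrorᵇ) (subst (Mirror ℓ) (cong (_+ r) b≡a+e+r) mirrorᶜ)))
    where
    e = p ∸ r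
    e+r≡p : e + r ≡ p
    e+r≡p = m∸n+n≡m (<⇒≤ r<p)
    b≡a+e+r : a + p ≡ a + e + r
    b≡a+e+r = trans (cong (a +_) (sym e+r≡p)) (sym (+-assoc a e r))
    a+e<b : a + e < a + p
    a+e<b = subst (a + e <_) (sym b≡a+e+r) (m<m+n (a + e) 0<r)

listAt-drop : ∀ {A : Set} m (xs : List A) k → listAt (drop m xs) (suc k) ≡ listAt xs (m + suc k)
listAt-drop zero    xs       k = refl
listAt-drop (suc m) []       k = refl
listAt-drop (suc m) (x ∷ xs) k rewrite +-suc m k = trans (listAt-drop m xs k) (cong (listAt xs) (+-suc m k))

take-suc-listAt : ∀ {A : Set} k (xs : List A) {y} → listAt xs (suc k) ≡ just y →
                  take (suc k) xs ≡ take k xs ++ y ∷ []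
take-suc-listAt zero    (x ∷ xs) x≡y = cong (_∷ []) (just-injective x≡y)
take-suc-listAt (suc k) (x ∷ xs) xs[k]≡y = cong (x ∷_) (take-suc-listAt k xs xs[k]≡y)

drop-listAt : ∀ {A : Set} k (xs : List A) {y} → listAt xs (suc k) ≡ just y → drop k xs ≡ y ∷ drop (suc k) xs
drop-listAt zero    (x ∷ xs) x≡y = cong (_∷ xs) (just-injective x≡y)
drop-listAt (suc k) (x ∷ xs) xs[k]≡y = drop-listAt k xs xs[k]≡y

take-+ : ∀ {A : Set} p q (xs : List A) → take (p + q) xs ≡ take p xs ++ take q (drop p xs)
take-+ zero    q xs       = refl
take-+ (suc p) q []       = sym (take-[] q)
take-+ (suc p) q (x ∷ xs) = cong (x ∷_) (take-+ p q xs)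

pow-sucʳ : ∀ {A : Set} (u : List A) t → pow u t ++ u ≡ pow u (suc t)
pow-sucʳ u zero    = sym (++-identityʳ u)
pow-sucʳ u (suc t) = trans (++-assoc u (pow u t) u) (cong (u ++_) (pow-sucʳ u t))

module _ {A : Set} (L : List A) where
  open Mirrors (listAt L)

  pal⇒block-reverse : ∀ {ℓ m} d → Pal ℓ m → d ≤ ℓ → d ≤ m →
                      take d (drop m L) ≡ reverse (take d (drop (m ∸ d) L))
  pal⇒block-reverse zero _ _ _ = refl
  pal⇒block-reverse {ℓ} {m} (suc d) pal d<ℓ d<m with pal (suc d) (s≤s z≤n) d<ℓ
  ... | a , L[m∸d] , L[m+1+d] = begin
    take (suc d) (drop m L)
      ≡⟨ take-suc-listAt d (drop m L) (trans (listAt-drop m L d) L[m+1+d]) ⟩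
    take d (drop m L) ++ a ∷ []
      ≡⟨ cong (_++ a ∷ []) (pal⇒block-reverse d pal (<⇒≤ d<ℓ) (<⇒≤ d<m)) ⟩
    reverse (take d (drop (m ∸ d) L)) ++ a ∷ []
      ≡⟨ unfold-reverse a (take d (drop (m ∸ d) L)) ⟨
    reverse (a ∷ take d (drop (m ∸ d) L))
      ≡⟨ cong (reverse ∘ take (suc d)) drop[m∸1+d] ⟨
    reverse (take (suc d) (drop (m ∸ suc d) L)) ∎
    where
    open ≡-Reasoning
    1+[m∸1+d]≡m∸d : suc (m ∸ suc d) ≡ m ∸ d
    1+[m∸1+d]≡m∸d = sym (+-∸-assoc 1 d<m)
    L[1+[m∸1+d]] : listAt L (suc (m ∸ suc d)) ≡ just a
    L[1+[m∸1+d]] = subst (λ t → listAt L t ≡ just a)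
                         (trans (cong (_∸ suc d) (+-comm m 1)) (sym 1+[m∸1+d]≡m∸d)) L[m∸d]
    drop[m∸1+d] : drop (m ∸ suc d) L ≡ a ∷ drop (m ∸ d) L
    drop[m∸1+d] = trans (drop-listAt (m ∸ suc d) L L[1+[m∸1+d]]) (cong (λ t → a ∷ drop t L) 1+[m∸1+d]≡m∸d)

  module AlternatingBlocks {ℓ} (i D N : ℕ) (D≤ℓ : D ≤ ℓ)
                           (pals : ∀ j → 1 ≤ j → j < N → Pal ℓ (i + j * D)) where

    w : List A
    w = take D (drop i L)

    block : ℕ → List A
    block j = take D (drop (i + j * D) L)

    prefix : ℕ → List A
    prefix k = take (k * D) (drop i L)

    block-suc : ∀ j → suc j < N → block (suc j) ≡ reverse (block j)
    block-suc j 1+j<N =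
      trans (pal⇒block-reverse D (pals (suc j) (s≤s z≤n) 1+j<N) D≤ℓ D≤i+[1+j]D)
            (cong (λ t → reverse (take D (drop t L))) i+[1+j]D∸D≡i+jD)
      where
      i+[1+j]D≡i+jD+D : i + suc j * D ≡ i + j * D + D
      i+[1+j]D≡i+jD+D = solve (i ∷ j ∷ D ∷ [])
      D≤i+[1+j]D : D ≤ i + suc j * D
      D≤i+[1+j]D = subst (D ≤_) (sym i+[1+j]D≡i+jD+D) (m≤n+m D (i + j * D))
      i+[1+j]D∸D≡i+jD : i + suc j * D ∸ D ≡ i + j * D
      i+[1+j]D∸D≡i+jD = trans (cong (_∸ D) i+[1+j]D≡i+jD+D) (m+n∸n≡m (i + j * D) D)

    block-even : ∀ t → 2 * t < N → block (2 * t) ≡ w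
    block-odd  : ∀ t → suc (2 * t) < N → block (suc (2 * t)) ≡ reverse w
    block-even zero    _     = cong (λ t → take D (drop t L)) (+-identityʳ i)
    block-even (suc t) 2t+2<N = begin
      block (2 * suc t)            ≡⟨ cong block (*-suc 2 t) ⟩
      block (suc (suc (2 * t)))    ≡⟨ block-suc (suc (2 * t)) (subst (_< N) (*-suc 2 t) 2t+2<N) ⟩
      reverse (block (suc (2 * t))) ≡⟨ cong reverse (block-odd t (<-trans (n<1+n _) (subst (_< N) (*-suc 2 t) 2t+2<N))) ⟩
      reverse (reverse w)          ≡⟨ reverse-involutive w ⟩
      w                            ∎
      where open ≡-Reasoning
    block-odd t 2t+1<N = trans (block-suc (2 * t) 2t+1<N) (cong reverse (block-even t (<-trans (n<1+n _) 2t+1<N)))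

    prefix-suc : ∀ k → prefix (suc k) ≡ prefix k ++ block k
    prefix-suc k = begin
      take (D + k * D) (drop i L)                      ≡⟨ cong (λ t → take t (drop i L)) (+-comm D (k * D)) ⟩
      take (k * D + D) (drop i L)                      ≡⟨ take-+ (k * D) D (drop i L) ⟩
      prefix k ++ take D (drop (k * D) (drop i L))     ≡⟨ cong (λ t → prefix k ++ take D t) (drop-drop i (k * D) L) ⟩
      prefix k ++ block k                              ∎
      where open ≡-Reasoning

    prefix-even : ∀ t → 2 * t ≤ N → prefix (2 * t) ≡ pow (w ++ reverse w) t
    prefix-odd  : ∀ t → suc (2 * t) ≤ N → prefix (suc (2 * t)) ≡ pow (w ++ reverse w) t ++ w
    prefix-even zero    _      = refl
    prefix-even (suc t) 2t+2≤N = begin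
      prefix (2 * suc t)                             ≡⟨ cong prefix (*-suc 2 t) ⟩
      prefix (suc (suc (2 * t)))                     ≡⟨ prefix-suc (suc (2 * t)) ⟩
      prefix (suc (2 * t)) ++ block (suc (2 * t))    ≡⟨ cong₂ _++_ (prefix-odd t (<⇒≤ 2t+2≤N′)) (block-odd t 2t+2≤N′) ⟩
      (pow (w ++ reverse w) t ++ w) ++ reverse w     ≡⟨ ++-assoc (pow (w ++ reverse w) t) w (reverse w) ⟩
      pow (w ++ reverse w) t ++ (w ++ reverse w)     ≡⟨ pow-sucʳ (w ++ reverse w) t ⟩
      pow (w ++ reverse w) (suc t)                   ∎
      where
      open ≡-Reasoning
      2t+2≤N′ : suc (suc (2 * t)) ≤ N
      2t+2≤N′ = subst (_≤ N) (*-suc 2 t) 2t+2≤N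
    prefix-odd t 2t+1≤N = trans (prefix-suc (2 * t))
                                (cong₂ _++_ (prefix-even t (<⇒≤ 2t+1≤N)) (block-even t 2t+1≤N))

substr-from : ∀ {A : Set} {n} (S : Vec A n) i j → substr S (i + 1) j ≡ take (j ∸ i) (drop i (toList S))
substr-from S i j rewrite +-comm i 1 = refl

module PalindromeRun {A : Set} {n : ℕ} (S : Vec A n) (ℓ* h : ℕ) (m : ℕ → ℕ)
  (3≤h : 3 ≤ h)
  (pal : ∀ j → 1 ≤ j → j ≤ h → IsPalMid S ℓ* (m j))
  (inc : ∀ j → 1 ≤ j → j < h → m j < m (suc j))
  (cons : ∀ x → m 1 < x → x < m h → IsPalMid S ℓ* x → ∃ λ j → 1 ≤ j × j ≤ h × m j ≡ x)
  (gap : ∀ j → 1 ≤ j → j < h → 2 * (m (suc j) ∸ m j) ≤ ℓ*) where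

  open Mirrors (S ‼_)

  S‼0 : S ‼ 0 ≡ nothing
  S‼0 with toList S
  ... | []    = refl
  ... | _ ∷ _ = refl

  mirror : ∀ j → 1 ≤ j → j ≤ h → Mirror ℓ* (m j)
  mirror j 1≤j j≤h = pal⇒mirror (pal j 1≤j j≤h)

  ℓ*≤m : ∀ j → 1 ≤ j → j ≤ h → ℓ* ≤ m j
  ℓ*≤m j 1≤j j≤h = pal⇒radius≤midpoint S‼0 (pal j 1≤j j≤h)

  m-mono : ∀ {i} j → 1 ≤ i → i ≤ j → j ≤ h → m i ≤ m j
  m-mono {i} zero    1≤i i≤0 _ = ⊥-elim (<-irrefl refl (≤-trans 1≤i i≤0))
  m-mono {i} (suc j) 1≤i i≤1+j 1+j≤h with i ≤? j
  ... | yes i≤j = ≤-trans (m-mono j 1≤i i≤j (<⇒≤ 1+j≤h)) (<⇒≤ (inc j (≤-trans 1≤i i≤j) 1+j≤h))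
  ... | no  i≰j = ≤-reflexive (cong m (≤-antisym i≤1+j (≰⇒> i≰j)))

  no-mirror-between : ∀ k → 1 ≤ k → k < h → NoMirrorBetween ℓ* (m k) (m (suc k))
  no-mirror-between k 1≤k k<h x mk<x x<mk+1 mirrorˣ
    with cons x (≤-<-trans (m-mono k ≤-refl 1≤k (<⇒≤ k<h)) mk<x)
                (<-≤-trans x<mk+1 (m-mono h (s≤s z≤n) k<h ≤-refl))
                (mirror⇒pal (≤-trans (ℓ*≤m k 1≤k (<⇒≤ k<h)) (<⇒≤ mk<x)) mirrorˣ)
  ... | j , 1≤j , j≤h , refl with j ≤? k
  ...   | yes j≤k = <-irrefl refl (<-≤-trans mk<x (m-mono k 1≤j j≤k (<⇒≤ k<h)))
  ...   | no  j≰k = <-irrefl refl (<-≤-trans x<mk+1 (m-mono j (s≤s z≤n) (≰⇒> j≰k) j≤h))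

  gap-step : ∀ k → 1 ≤ k → suc k < h → m (suc (suc k)) ∸ m (suc k) ≡ m (suc k) ∸ m k
  gap-step k 1≤k 2+k≤h =
    consecutive-gaps-equal (ℓ*≤m k 1≤k k≤h) (inc k 1≤k k<h) (inc (suc k) (s≤s z≤n) 2+k≤h)
      (gap k 1≤k k<h) (gap (suc k) (s≤s z≤n) 2+k≤h)
      (mirror k 1≤k k≤h) (mirror (suc k) (s≤s z≤n) (<⇒≤ 2+k≤h)) (mirror (suc (suc k)) (s≤s z≤n) 2+k≤h)
      (no-mirror-between k 1≤k k<h) (no-mirror-between (suc k) (s≤s z≤n) 2+k≤h)
    where
    k<h : k < h
    k<h = <-trans (n<1+n k) 2+k≤h
    k≤h : k ≤ h
    k≤h = <⇒≤ k<h

  gaps-constant : ∀ k → 1 ≤ k → k < h → m (suc k) ∸ m k ≡ m 2 ∸ m 1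
  gaps-constant (suc zero)    _ _     = refl
  gaps-constant (suc (suc k)) _ 3+k≤h =
    trans (gap-step (suc k) (s≤s z≤n) 3+k≤h) (gaps-constant (suc k) (s≤s z≤n) (<-trans (n<1+n _) 3+k≤h))

  D : ℕ
  D = m 2 ∸ m 1

  m-linear : ∀ j → suc j ≤ h → m (suc j) ≡ m 1 + j * D
  m-linear zero    _     = sym (+-identityʳ (m 1))
  m-linear (suc j) 2+j≤h = begin
    m (suc (suc j))                              ≡⟨ m+[n∸m]≡n (<⇒≤ (inc (suc j) (s≤s z≤n) 2+j≤h)) ⟨
    m (suc j) + (m (suc (suc j)) ∸ m (suc j))    ≡⟨ cong₂ _+_ (m-linear j (<⇒≤ 2+j≤h)) (gaps-constant (suc j) (s≤s z≤n) 2+j≤h) ⟩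
    m 1 + j * D + D                              ≡⟨ +-assoc (m 1) (j * D) D ⟩
    m 1 + (j * D + D)                            ≡⟨ cong (m 1 +_) (+-comm (j * D) D) ⟩
    m 1 + suc j * D                              ∎
    where open ≡-Reasoning

  D≤ℓ* : D ≤ ℓ*
  D≤ℓ* = ≤-trans (m≤m+n D (D + 0)) (gap 1 ≤-refl (≤-trans (s≤s (s≤s z≤n)) 3≤h))

  pals-between : ∀ N → suc N ≤ h → ∀ j → 1 ≤ j → j < N → Pal ℓ* (m 1 + j * D)
  pals-between N 1+N≤h j 1≤j j<N =
    subst (Pal ℓ*) (m-linear j 1+j≤h) (pal (suc j) (s≤s z≤n) 1+j≤h)
    where
    1+j≤h : suc j ≤ h
    1+j≤h = ≤-trans (s≤s (<⇒≤ j<N)) 1+N≤h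

  module Blocks (N : ℕ) (1+N≤h : suc N ≤ h) =
    AlternatingBlocks (toList S) (m 1) D N D≤ℓ* (pals-between N 1+N≤h)

  S[m₁+1,m[1+N]]≡prefix : ∀ N (1+N≤h : suc N ≤ h) → substr S (m 1 + 1) (m (suc N)) ≡ Blocks.prefix N 1+N≤h N
  S[m₁+1,m[1+N]]≡prefix N 1+N≤h = begin
    substr S (m 1 + 1) (m (suc N))                   ≡⟨ substr-from S (m 1) (m (suc N)) ⟩
    take (m (suc N) ∸ m 1) (drop (m 1) (toList S))   ≡⟨ cong (λ t → take (t ∸ m 1) (drop (m 1) (toList S))) (m-linear N 1+N≤h) ⟩
    take (m 1 + N * D ∸ m 1) (drop (m 1) (toList S)) ≡⟨ cong (λ t → take t (drop (m 1) (toList S))) (m+n∸m≡n (m 1) (N * D)) ⟩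
    take (N * D) (drop (m 1) (toList S))             ∎
    where open ≡-Reasoning

  factorisation-odd : ∀ t → h ≡ 2 * t + 1 →
    substr S (m 1 + 1) (m h) ≡ pow (substr S (m 1 + 1) (m 2) ++ reverse (substr S (m 1 + 1) (m 2))) t
  factorisation-odd t h≡2t+1 = begin
    substr S (m 1 + 1) (m h)                   ≡⟨ cong (substr S (m 1 + 1) ∘ m) h≡1+2t ⟩
    substr S (m 1 + 1) (m (suc (2 * t)))       ≡⟨ S[m₁+1,m[1+N]]≡prefix (2 * t) 1+2t≤h ⟩
    Blocks.prefix (2 * t) 1+2t≤h (2 * t)       ≡⟨ Blocks.prefix-even (2 * t) 1+2t≤h t ≤-refl ⟩
    pow (w ++ reverse w) t                     ≡⟨ cong (λ u → pow (u ++ reverse u) t) (substr-from S (m 1) (m 2)) ⟨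
    pow (substr S (m 1 + 1) (m 2) ++ reverse (substr S (m 1 + 1) (m 2))) t ∎
    where
    open ≡-Reasoning
    h≡1+2t : h ≡ suc (2 * t)
    h≡1+2t = trans h≡2t+1 (+-comm (2 * t) 1)
    1+2t≤h : suc (2 * t) ≤ h
    1+2t≤h = ≤-reflexive (sym h≡1+2t)
    w = take D (drop (m 1) (toList S))

  factorisation-even : ∀ t → h ≡ 2 * t + 2 →
    substr S (m 1 + 1) (m h)
      ≡ pow (substr S (m 1 + 1) (m 2) ++ reverse (substr S (m 1 + 1) (m 2))) t ++ substr S (m 1 + 1) (m 2)
  factorisation-even t h≡2t+2 = begin
    substr S (m 1 + 1) (m h)                         ≡⟨ cong (substr S (m 1 + 1) ∘ m) h≡2+2t ⟩
    substr S (m 1 + 1) (m (suc (suc (2 * t))))       ≡⟨ S[m₁+1,m[1+N]]≡prefix (suc (2 * t)) 2+2t≤h ⟩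
    Blocks.prefix (suc (2 * t)) 2+2t≤h (suc (2 * t)) ≡⟨ Blocks.prefix-odd (suc (2 * t)) 2+2t≤h t ≤-refl ⟩
    pow (w ++ reverse w) t ++ w                      ≡⟨ cong (λ u → pow (u ++ reverse u) t ++ u) (substr-from S (m 1) (m 2)) ⟨
    pow (substr S (m 1 + 1) (m 2) ++ reverse (substr S (m 1 + 1) (m 2))) t ++ substr S (m 1 + 1) (m 2) ∎
    where
    open ≡-Reasoning
    h≡2+2t : h ≡ suc (suc (2 * t))
    h≡2+2t = trans h≡2t+2 (+-comm (2 * t) 2)
    2+2t≤h : suc (suc (2 * t)) ≤ h
    2+2t≤h = ≤-reflexive (sym h≡2+2t)
    w = take D (drop (m 1) (toList S))

corollary1 : {A : Set} {n : ℕ} (S : Vec A n) (ℓ* h : ℕ) (m : ℕ → ℕ) →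
    3 ≤ h →
    (∀ j → 1 ≤ j → j ≤ h → IsPalMid S ℓ* (m j)) →
    (∀ j → 1 ≤ j → j < h → m j < m (suc j)) →
    (∀ x → m 1 < x → x < m h → IsPalMid S ℓ* x → ∃ λ j → 1 ≤ j × j ≤ h × m j ≡ x) →
    (∀ j → 1 ≤ j → j < h → 2 * (m (suc j) ∸ m j) ≤ ℓ*) →
    (∀ k → 1 ≤ k → k < h → m (suc k) ∸ m k ≡ m 2 ∸ m 1)
    × (∀ t →
        (h ≡ 2 * t + 1 →
          substr S (m 1 + 1) (m h)
            ≡ pow (substr S (m 1 + 1) (m 2) ++ reverse (substr S (m 1 + 1) (m 2))) t)
        × (h ≡ 2 * t + 2 →
          substr S (m 1 + 1) (m h)
            ≡ pow (substr S (m 1 + 1) (m 2) ++ reverse (substr S (m 1 + 1) (m 2))) t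
              ++ substr S (m 1 + 1) (m 2)))
corollary1 S ℓ* h m 3≤h pal inc cons gap =
  gaps-constant , λ t → factorisation-odd t , factorisation-even t
  where open PalindromeRun S ℓ* h m 3≤h pal inc cons gap
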